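{- Let $A$ be a finite alphabet with $|A|\ge 2$. If $L\subseteq A^*$ is regular and $m\geq 0$, then $L^+(m)$ and $L^-(m)$ are regular.
   Context: Subword relation: $w\sqsubseteq v$ iff there are $n\geq 0$, $a_1,\dots,a_n\in A$, $v_0,\dots,v_n\in A^*$ with $w=a_1\cdots a_n$ and $v=v_0a_1v_1\cdots a_nv_n$. For $m\geq 0$ and $w,v\in A^*$, write $w\to^m_L v$ iff there exist $w_0,\dots,w_m\in A^*$ with $w=w_0\sqsubseteq w_1\sqsubseteq\cdots\sqsubseteq w_m\sqsubseteq v$ and ($w_i\in L\iff w_{i+1}\notin L$) for $0\leq i\leq m-1$. Define $L^+(m)=\{v\in A^*:\exists w\in L,\ w\to^m_L v\}$ and $L^-(m)=\{v\in A^*:\exists w\notin L,\ w\to^m_L v\}$. -}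

module Defs where

open import Data.Nat using (ℕ; zero; suc)
open import Data.Fin using (Fin)
open import Data.Bool using (Bool; T)
open import Data.List using (List; []; _∷_)
open import Data.Product using (Σ; ∃; _×_)
open import Relation.Nullary using (¬_)
open import Function.Bundles using (_⇔_)
open import Data.List.Relation.Binary.Sublist.Propositional using (_⊆_)

Language : Set → Set₁
Language A = List A → Set

record DFA (A : Set) : Set where
  field
    states : ℕ
    start  : Fin states
    δ      : Fin states → A → Fin states
    final  : Fin states → Bool

  δ* : Fin states → List A → Fin states
  δ* q []       = q
  δ* q (a ∷ w)  = δ* (δ q a) w

  accepts : List A → Set
  accepts w = T (final (δ* start w))

Regular : {A : Set} → Language A → Set
Regular {A} L = Σ (DFA A) λ M → ∀ w → (L w ⇔ DFA.accepts M w)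

-- Subword (scattered subsequence) relation w ⊑ v.
_⊑_ : {A : Set} → List A → List A → Set
w ⊑ v = w ⊆ v

Chain : {A : Set} → Language A → ℕ → List A → List A → Set
Chain L zero    w v = w ⊑ v
Chain L (suc m) w v = ∃ λ w₁ → (w ⊑ w₁) × (L w ⇔ (¬ L w₁)) × Chain L m w₁ v

Lplus : {A : Set} → Language A → ℕ → Language A
Lplus L m v = ∃ λ w → L w × Chain L m w v

Lminus : {A : Set} → Language A → ℕ → Language A
Lminus L m v = ∃ λ w → (¬ L w) × Chain L m w v

{-# OPTIONS --safe #-}
-- Since consecutive elements of a chain alternate membership in L, the i-th element of a
-- chain starting in L (resp. in its complement) lies in L or in its complement according
-- to the parity of i, so the alternation condition becomes membership in a fixed regular
-- language. Hence L⁺(m) and L⁻(m) arise from L and its complement by m rounds of "upward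
-- closure, then intersection with the other side", followed by a final upward closure.
-- Regular languages are closed under complement, intersection (product automaton) and
-- upward closure under ⊑ (a subset automaton that may skip any letter).
module Submission where

open import Defs
open import Data.Nat using (ℕ; _≤_; zero; suc; _*_; _^_)
open import Data.Fin using (Fin; _≟_)
open import Data.Fin.Properties using (any?; 2↔Bool; *↔×)
open import Data.Product using (_×_; _,_; ∃; proj₂)
open import Data.Product.Function.NonDependent.Propositional using (_×-⇔_; _×-↔_)
open import Data.Sum using (inj₁; inj₂)
open import Data.Bool using (Bool; true; false; T; not; _∧_)
open import Data.Bool.Properties using (T-∧)
open import Data.List using ([]; _∷_; foldl)
open import Data.List.Relation.Binary.Sublist.Propositional using ([]; _∷_; _∷ʳ_)
open import Data.Vec using (Vec; lookup; tabulate)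
open import Data.Vec.Properties using (lookup∘tabulate)
open import Data.Vec.Recursive using (Fin[m^n]↔Fin[m]^n; lift↔)
open import Data.Vec.Recursive.Properties using (↔Vec)
open import Data.Unit using (tt)
open import Data.Empty using (⊥-elim)
open import Function using (id; _∘_)
open import Function.Bundles using (_⇔_; mk⇔; Equivalence; _↔_; Inverse)
open import Function.Properties.Equivalence using () renaming (sym to ⇔-sym; trans to ⇔-trans)
open import Function.Properties.Inverse using (↔-refl; ↔-sym; ↔-trans)
open import Function.Related.TypeIsomorphisms using (¬-cong-⇔)
open import Level using (0ℓ)
open import Relation.Nullary using (¬_; Dec; yes; no)
open import Relation.Nullary.Decidable using (⌊_⌋; toWitness; fromWitness; T?; map; _×-dec_; _⊎-dec_)
open import Relation.Unary using (Pred; ∁; _∩_; Decidable; _⊆_)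
open import Relation.Binary.PropositionalEquality using (_≡_; refl; cong; subst; sym; trans)

open Equivalence using (to; from)

T-⌊⌋⇔ : ∀ {P : Set} {P? : Dec P} → T ⌊ P? ⌋ ⇔ P
T-⌊⌋⇔ = mk⇔ toWitness fromWitness

T-not⇔¬T : ∀ b → T (not b) ⇔ (¬ T b)
T-not⇔¬T true  = mk⇔ (λ ()) (λ ¬t → ¬t tt)
T-not⇔¬T false = mk⇔ (λ _ ()) (λ _ → tt)

Vec↔Fin[2^n] : ∀ n → Vec Bool n ↔ Fin (2 ^ n)
Vec↔Fin[2^n] n =
  ↔-sym (↔-trans (Fin[m^n]↔Fin[m]^n 2 n) (↔-trans (lift↔ n 2↔Bool) (↔Vec n)))

-- As DFA, but over any state type in bijection with some Fin n, so that the product and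
-- subset constructions below need no hand-made encoding of their states into Fin.
record Automaton (A : Set) : Set₁ where
  field
    State     : Set
    size      : ℕ
    encode    : State ↔ Fin size
    start     : State
    step      : State → A → State
    accepting : State → Bool

  Accepts : Language A
  Accepts w = T (accepting (foldl step start w))

Recognises : {A : Set} → Automaton A → Language A → Set
Recognises M L = ∀ w → L w ⇔ Automaton.Accepts M w

module _ {A : Set} where

  module _ (M : Automaton A) where
    open Automaton M
    module E = Inverse encode

    toDFA : DFA A
    toDFA = record
      { states = size
      ; start  = E.to start
      ; δ      = λ q a → E.to (step (E.from q) a)
      ; final  = accepting ∘ E.from
      }

    δ*-toDFA : ∀ q w → DFA.δ* toDFA (E.to q) w ≡ E.to (foldl step q w)
    δ*-toDFA q []      = refl
    δ*-toDFA q (a ∷ w) =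
      trans (cong (λ p → DFA.δ* toDFA (E.to (step p a)) w) (E.strictlyInverseʳ q))
            (δ*-toDFA (step q a) w)

    accepts-toDFA : ∀ w → DFA.accepts toDFA w ≡ Accepts w
    accepts-toDFA w = cong (T ∘ accepting)
      (trans (cong E.from (δ*-toDFA start w)) (E.strictlyInverseʳ _))

    Recognises⇒Regular : {L : Language A} → Recognises M L → Regular L
    Recognises⇒Regular {L} rec = toDFA , λ w → subst (L w ⇔_) (sym (accepts-toDFA w)) (rec w)

  fromDFA : DFA A → Automaton A
  fromDFA M = record
    { State = Fin states ; size = states ; encode = ↔-refl
    ; start = start ; step = δ ; accepting = final }
    where open DFA M

  δ*≡foldl : (M : DFA A) → ∀ q w → DFA.δ* M q w ≡ foldl (DFA.δ M) q w
  δ*≡foldl M q []      = refl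
  δ*≡foldl M q (a ∷ w) = δ*≡foldl M (DFA.δ M q a) w

  Recognises-fromDFA : {L : Language A} ((M , _) : Regular L) → Recognises (fromDFA M) L
  Recognises-fromDFA {L} (M , h) w =
    subst (λ q → L w ⇔ T (DFA.final M q)) (δ*≡foldl M (DFA.start M) w) (h w)

  complement : Automaton A → Automaton A
  complement M = record M { accepting = not ∘ Automaton.accepting M }

  Recognises-complement : ∀ M {K} → Recognises M K → Recognises (complement M) (∁ K)
  Recognises-complement M rec w = ⇔-trans (¬-cong-⇔ (rec w)) (⇔-sym (T-not⇔¬T _))

  module _ (M N : Automaton A) where
    private
      module M = Automaton M
      module N = Automaton N

    step× : M.State × N.State → A → M.State × N.State
    step× (p , q) a = M.step p a , N.step q a

    foldl-step× : ∀ p q w → foldl step× (p , q) w ≡ (foldl M.step p w , foldl N.step q w)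
    foldl-step× p q []      = refl
    foldl-step× p q (a ∷ w) = foldl-step× (M.step p a) (N.step q a) w

    _⊗_ : Automaton A
    _⊗_ = record
      { State     = M.State × N.State
      ; size      = M.size * N.size
      ; encode    = ↔-trans (M.encode ×-↔ N.encode) (↔-sym *↔×)
      ; start     = M.start , N.start
      ; step      = step×
      ; accepting = λ (p , q) → M.accepting p ∧ N.accepting q
      }

    Recognises-⊗ : ∀ {K K′} → Recognises M K → Recognises N K′ → Recognises _⊗_ (K ∩ K′)
    Recognises-⊗ recK recK′ w =
      subst (λ (p , q) → _ ⇔ T (M.accepting p ∧ N.accepting q))
            (sym (foldl-step× M.start N.start w))
            (⇔-trans (recK w ×-⇔ recK′ w) (⇔-sym T-∧))

  Regular-resp-⇔ : {K K′ : Language A} → (∀ w → K w ⇔ K′ w) → Regular K → Regular K′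
  Regular-resp-⇔ K⇔K′ (M , h) = M , λ w → ⇔-trans (⇔-sym (K⇔K′ w)) (h w)

  Regular⇒Decidable : {K : Language A} → Regular K → Decidable K
  Regular⇒Decidable (M , h) w = map (⇔-sym (h w)) (T? _)

  Regular-∁ : {K : Language A} → Regular K → Regular (∁ K)
  Regular-∁ RK@(M , _) =
    Recognises⇒Regular (complement (fromDFA M))
      (Recognises-complement (fromDFA M) (Recognises-fromDFA RK))

  Regular-∩ : {K K′ : Language A} → Regular K → Regular K′ → Regular (K ∩ K′)
  Regular-∩ RK@(M , _) RK′@(N , _) =
    Recognises⇒Regular (fromDFA M ⊗ fromDFA N)
      (Recognises-⊗ (fromDFA M) (fromDFA N) (Recognises-fromDFA RK) (Recognises-fromDFA RK′))

  ↑ : Language A → Language A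
  ↑ K v = ∃ λ w → K w × w ⊑ v

  module SubsetAutomaton (M : DFA A) where
    open DFA M

    StateSet : Set
    StateSet = Vec Bool states

    _∈_ : Fin states → StateSet → Set
    q ∈ X = T (lookup X q)

    _∈?_ : ∀ q X → Dec (q ∈ X)
    q ∈? X = T? (lookup X q)

    ｛_｝ : {P : Pred (Fin states) 0ℓ} → Decidable P → StateSet
    ｛ P? ｝ = tabulate (⌊_⌋ ∘ P?)

    ∈｛｝ : {P : Pred (Fin states) 0ℓ} {P? : Decidable P} → ∀ q → q ∈ ｛ P? ｝ ⇔ P q
    ∈｛｝ {P? = P?} q = subst (λ b → T b ⇔ _) (sym (lookup∘tabulate (⌊_⌋ ∘ P?) q)) T-⌊⌋⇔

    -- Reading a letter either skips it (the state stays) or follows the transition.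
    step : StateSet → A → StateSet
    step X a = ｛ (λ q′ → q′ ∈? X ⊎-dec any? (λ q → q ∈? X ×-dec δ q a ≟ q′)) ｝

    ∈-foldl⁺ : ∀ {q w v} X → q ∈ X → w ⊑ v → δ* q w ∈ foldl step X v
    ∈-foldl⁺ X q∈X []           = q∈X
    ∈-foldl⁺ X q∈X (a ∷ʳ w⊑v)   = ∈-foldl⁺ (step X a) (from (∈｛｝ _) (inj₁ q∈X)) w⊑v
    ∈-foldl⁺ X q∈X (refl ∷ w⊑v) =
      ∈-foldl⁺ (step X _) (from (∈｛｝ _) (inj₂ (_ , q∈X , refl))) w⊑v

    ∈-foldl⁻ : ∀ {q′} X v → q′ ∈ foldl step X v →
               ∃ λ q → q ∈ X × ∃ λ w → w ⊑ v × δ* q w ≡ q′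
    ∈-foldl⁻ X []      q′∈X = _ , q′∈X , [] , [] , refl
    ∈-foldl⁻ X (a ∷ v) q′∈ with ∈-foldl⁻ (step X a) v q′∈
    ... | p , p∈ , w , w⊑v , refl with to (∈｛｝ p) p∈
    ...   | inj₁ p∈X              = p , p∈X , w , a ∷ʳ w⊑v , refl
    ...   | inj₂ (q , q∈X , refl) = q , q∈X , a ∷ w , refl ∷ w⊑v , refl

    subsetAutomaton : Automaton A
    subsetAutomaton = record
      { State     = StateSet
      ; size      = 2 ^ states
      ; encode    = Vec↔Fin[2^n] states
      ; start     = ｛ _≟ start ｝
      ; step      = step
      ; accepting = λ X → ⌊ any? (λ q → q ∈? X ×-dec T? (final q)) ⌋
      }

  Regular-↑ : {K : Language A} → Regular K → Regular (↑ K)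
  Regular-↑ {K} (M , h) = Recognises⇒Regular subsetAutomaton λ v → mk⇔
    (λ (w , w∈K , w⊑v) →
       fromWitness (_ , ∈-foldl⁺ _ (from (∈｛｝ _) refl) w⊑v , to (h w) w∈K))
    (accepted ∘ toWitness)
    where
    open DFA M using (start; final)
    open SubsetAutomaton M
    accepted : ∀ {v} → ∃ (λ q′ → q′ ∈ foldl step ｛ _≟ start ｝ v × T (final q′)) → ↑ K v
    accepted {v} (q′ , q′∈ , q′-final) with ∈-foldl⁻ _ v q′∈
    ... | q , q∈ , w , w⊑v , refl with to (∈｛｝ q) q∈
    ...   | refl = w , from (h w) q′-final , w⊑v

  module Chains (L : Language A) (L-regular : Regular L) where

    Side : Bool → Language A
    Side true  = L
    Side false = ∁ L

    Regular-Side : ∀ b → Regular (Side b)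
    Regular-Side true  = L-regular
    Regular-Side false = Regular-∁ L-regular

    alternates⇔Side-not : ∀ b {w w₁} → Side b w → (L w ⇔ (¬ L w₁)) ⇔ Side (not b) w₁
    alternates⇔Side-not true  w∈L =
      mk⇔ (λ alt → to alt w∈L) (λ w₁∉L → mk⇔ (λ _ → w₁∉L) (λ _ → w∈L))
    alternates⇔Side-not false {w₁ = w₁} w∉L = mk⇔ w₁∈L
      (λ w₁∈L → mk⇔ (⊥-elim ∘ w∉L) (λ w₁∉L → ⊥-elim (w₁∉L w₁∈L)))
      where
      w₁∈L : (L _ ⇔ (¬ L w₁)) → L w₁
      w₁∈L alt with Regular⇒Decidable L-regular w₁
      ... | yes w₁∈L = w₁∈L
      ... | no  w₁∉L = ⊥-elim (w∉L (from alt w₁∉L))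

    ChainsFrom : Language A → ℕ → Language A
    ChainsFrom X m v = ∃ λ w → X w × Chain L m w v

    ChainsFrom-suc : ∀ {b X} → X ⊆ Side b → ∀ m v →
                     ChainsFrom X (suc m) v ⇔ ChainsFrom (↑ X ∩ Side (not b)) m v
    ChainsFrom-suc {b} X⊆Side m v = mk⇔
      (λ (w , w∈X , w₁ , w⊑w₁ , alt , chain) →
         w₁ , ((w , w∈X , w⊑w₁) , to (alternates⇔Side-not b (X⊆Side w∈X)) alt) , chain)
      (λ (w₁ , ((w , w∈X , w⊑w₁) , w₁∈Side) , chain) →
         w , w∈X , w₁ , w⊑w₁ , from (alternates⇔Side-not b (X⊆Side w∈X)) w₁∈Side , chain)

    Regular-ChainsFrom : ∀ m b {X} → Regular X → X ⊆ Side b → Regular (ChainsFrom X m)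
    Regular-ChainsFrom zero    b RX X⊆Side = Regular-↑ RX
    Regular-ChainsFrom (suc m) b RX X⊆Side =
      Regular-resp-⇔ (λ v → ⇔-sym (ChainsFrom-suc {b} X⊆Side m v))
        (Regular-ChainsFrom m (not b) (Regular-∩ (Regular-↑ RX) (Regular-Side (not b))) proj₂)

lemma3p5 : (k : ℕ) → 2 ≤ k → (L : Language (Fin k)) → Regular L → (m : ℕ) →
    Regular (Lplus L m) × Regular (Lminus L m)
lemma3p5 k _ L RL m =
    Regular-ChainsFrom m true RL id , Regular-ChainsFrom m false (Regular-∁ RL) id
  where open Chains L RL
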